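{- Let $\pi=\pi_1\cdots\pi_n\in\mathcal{S}_n$ and $i\neq j$. The vertices $\pi_i$ and $\pi_j$ are adjacent in the competition graph $C(\pi)$ if and only if $\pi_i$ and $\pi_j$ are the terms playing the roles of "2" and "3" in some occurrence of the pattern $123$ or of the pattern $132$ in $\pi$.
   Context: $D(\pi)$ is the digraph with vertex set the points $(i,\pi_i)$, $1\le i\le n$ (the vertex $(i,\pi_i)$ is referred to as $\pi_i$), with an arc from $(j,\pi_j)$ to $(i,\pi_i)$ iff $i<j$ and $\pi_i<\pi_j$. The competition graph $C(\pi)$ is the undirected simple graph on the same vertices in which distinct $x,y$ are adjacent iff some vertex $u$ has arcs $(x,u)$ and $(y,u)$ in $D(\pi)$. An occurrence of a pattern $\tau\in\mathcal{S}_k$ in $\pi$ is a subsequence $\pi_{i_1}\cdots\pi_{i_k}$ ($i_1<\cdots<i_k$) order-isomorphic to $\tau$; the term $\pi_{i_r}$ plays the role of the letter $\tau_r$. -}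

module Defs where

open import Data.Nat using (ℕ)
open import Data.Fin using (Fin; _<_)
open import Data.Fin.Permutation using (Permutation′; _⟨$⟩ʳ_)
open import Data.Product using (Σ; ∃; _×_; _,_)
open import Data.Sum using (_⊎_)
open import Relation.Binary.PropositionalEquality using (_≡_)
open import Relation.Nullary using (¬_)

-- A permutation π ∈ S_n, positions and values are Fin n; π_i = π ⟨$⟩ʳ i.
-- Vertices of D(π) / C(π) are identified with their positions i
-- (the vertex (i, π_i)).

-- Arc from (j,π_j) to (i,π_i) in D(π) iff i < j and π_i < π_j.
Arc : ∀ {n} → Permutation′ n → Fin n → Fin n → Set
Arc π j i = (i < j) × ((π ⟨$⟩ʳ i) < (π ⟨$⟩ʳ j))

Adjacent : ∀ {n} → Permutation′ n → Fin n → Fin n → Set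
Adjacent π x y = ¬ (x ≡ y) × ∃ λ u → Arc π x u × Arc π y u

Occ123 : ∀ {n} → Permutation′ n → Fin n → Fin n → Fin n → Set
Occ123 π p q r = (p < q) × (q < r) ×
  ((π ⟨$⟩ʳ p) < (π ⟨$⟩ʳ q)) × ((π ⟨$⟩ʳ q) < (π ⟨$⟩ʳ r))

Occ132 : ∀ {n} → Permutation′ n → Fin n → Fin n → Fin n → Set
Occ132 π p q r = (p < q) × (q < r) ×
  ((π ⟨$⟩ʳ p) < (π ⟨$⟩ʳ r)) × ((π ⟨$⟩ʳ r) < (π ⟨$⟩ʳ q))

Plays23 : ∀ {n} → Permutation′ n → Fin n → Fin n → Set
Plays23 π x y =
  (∃ λ p → (Occ123 π p x y ⊎ Occ123 π p y x))
  ⊎ (∃ λ p → (Occ132 π p y x ⊎ Occ132 π p x y))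

module Submission where

-- In D(π) every arc points down and to the left, so two
-- vertices π_i, π_j have a common out-neighbour π_p exactly when p lies to
-- the left of both and π_p lies below both.  Such a p together with i and j
-- is an occurrence of a length-3 pattern whose first letter is the "1";
-- the relative order of i, j (positions) and of π_i, π_j (values) decides
-- whether it is 123 or 132 and which of π_i, π_j plays "2" or "3".

open import Defs
open import Data.Nat using (ℕ)
open import Data.Fin using (Fin)
open import Data.Fin.Permutation using (Permutation′; _⟨$⟩ʳ_)
open import Data.Fin.Properties using (<-cmp; <-trans)
open import Data.Product using (∃; _×_; _,_)
open import Data.Sum using (inj₁; inj₂)
open import Data.Empty using (⊥-elim)
open import Function.Bundles using (_⇔_; mk⇔; Injection)
open import Function.Properties.Inverse using (↔⇒↣)
open import Relation.Binary using (tri<; tri≈; tri>)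
open import Relation.Binary.PropositionalEquality using (_≡_)
open import Relation.Nullary using (¬_)

permutation-injective : ∀ {n} (π : Permutation′ n) {i j : Fin n} →
  π ⟨$⟩ʳ i ≡ π ⟨$⟩ʳ j → i ≡ j
permutation-injective π = Injection.injective (↔⇒↣ π)

common-sink⇒Plays23 : ∀ {n} (π : Permutation′ n) {i j : Fin n} → ¬ (i ≡ j) →
  (u : Fin n) → Arc π i u → Arc π j u → Plays23 π i j
common-sink⇒Plays23 π {i} {j} i≢j u (u<i , πu<πi) (u<j , πu<πj)
  with <-cmp i j | <-cmp (π ⟨$⟩ʳ i) (π ⟨$⟩ʳ j)
... | tri≈ _ i≡j _ | _             = ⊥-elim (i≢j i≡j)
... | _            | tri≈ _ πi≡πj _ = ⊥-elim (i≢j (permutation-injective π πi≡πj))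
... | tri< i<j _ _ | tri< πi<πj _ _ = inj₁ (u , inj₁ (u<i , i<j , πu<πi , πi<πj))
... | tri< i<j _ _ | tri> _ _ πj<πi = inj₂ (u , inj₂ (u<i , i<j , πu<πj , πj<πi))
... | tri> _ _ j<i | tri< πi<πj _ _ = inj₂ (u , inj₁ (u<j , j<i , πu<πi , πi<πj))
... | tri> _ _ j<i | tri> _ _ πj<πi = inj₁ (u , inj₂ (u<j , j<i , πu<πj , πj<πi))

Occ123⇒arcs : ∀ {n} (π : Permutation′ n) {p q r : Fin n} →
  Occ123 π p q r → Arc π q p × Arc π r p
Occ123⇒arcs π (p<q , q<r , πp<πq , πq<πr) =
  (p<q , πp<πq) , (<-trans p<q q<r , <-trans πp<πq πq<πr)

Occ132⇒arcs : ∀ {n} (π : Permutation′ n) {p q r : Fin n} →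
  Occ132 π p q r → Arc π q p × Arc π r p
Occ132⇒arcs π (p<q , q<r , πp<πr , πr<πq) =
  (p<q , <-trans πp<πr πr<πq) , (<-trans p<q q<r , πp<πr)

Plays23⇒common-sink : ∀ {n} (π : Permutation′ n) {i j : Fin n} →
  Plays23 π i j → ∃ λ u → Arc π i u × Arc π j u
Plays23⇒common-sink π (inj₁ (p , inj₁ occ)) = p , Occ123⇒arcs π occ
Plays23⇒common-sink π (inj₁ (p , inj₂ occ)) =
  let (ip , jp) = Occ123⇒arcs π occ in p , jp , ip
Plays23⇒common-sink π (inj₂ (p , inj₁ occ)) =
  let (jp , ip) = Occ132⇒arcs π occ in p , ip , jp
Plays23⇒common-sink π (inj₂ (p , inj₂ occ)) = p , Occ132⇒arcs π occ

mainTheorem2 : (n : ℕ) (π : Permutation′ n) (i j : Fin n) → ¬ (i ≡ j) →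
    Adjacent π i j ⇔ Plays23 π i j
mainTheorem2 n π i j i≢j = mk⇔ adjacent⇒Plays23 Plays23⇒adjacent
  where
  adjacent⇒Plays23 : Adjacent π i j → Plays23 π i j
  adjacent⇒Plays23 (_ , u , iu , ju) = common-sink⇒Plays23 π i≢j u iu ju

  Plays23⇒adjacent : Plays23 π i j → Adjacent π i j
  Plays23⇒adjacent occ = i≢j , Plays23⇒common-sink π occ
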